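{- The maximum rank oracle (Max) is not polynomially reducible to any of the following: the minimum rank oracle (Min), the rank sum oracle (Sum), and the common independence oracle (CI).
   Context: Let $\mathbf{M}_1=(E,\mathcal{I}_1)$, $\mathbf{M}_2=(E,\mathcal{I}_2)$ be loopless matroids on a common finite ground set $E$ with rank functions $r_1,r_2$. For a queried $X\subseteq E$: Sum returns $r_1(X)+r_2(X)$; Min returns $\min\{r_1(X),r_2(X)\}$; Max returns $\max\{r_1(X),r_2(X)\}$; CI returns ``Yes'' if $X\in\mathcal{I}_1\cap\mathcal{I}_2$ and ``No'' otherwise. An oracle $\mathcal{O}_1$ is polynomially reducible to an oracle $\mathcal{O}_2$ if, for every such pair of matroids, the answer of $\mathcal{O}_1$ to any query can be computed using a number of calls to $\mathcal{O}_2$ bounded by a polynomial in $|E|$ (in particular, the answers of $\mathcal{O}_2$ must determine those of $\mathcal{O}_1$). -}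

module Defs where

open import Data.Nat using (ℕ; suc; _+_; _*_; _^_; _≤_; _≟_)
open import Data.Nat using () renaming (_⊓_ to min; _⊔_ to max)
open import Data.Bool using (Bool; _∧_)
open import Data.Fin.Subset using (Subset; ∣_∣; ⁅_⁆; _∪_; _∩_; _⊆_)
open import Data.Product using (Σ; ∃; _×_; _,_; proj₁; proj₂)
open import Relation.Binary.PropositionalEquality using (_≡_)
open import Relation.Nullary using (¬_)
open import Relation.Nullary.Decidable using (⌊_⌋)

record Matroid (n : ℕ) : Set where
  field
    rank      : Subset n → ℕ
    rank-≤    : ∀ X → rank X ≤ ∣ X ∣
    rank-mono : ∀ X Y → X ⊆ Y → rank X ≤ rank Y
    rank-sub  : ∀ X Y → rank (X ∪ Y) + rank (X ∩ Y) ≤ rank X + rank Y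
open Matroid public

Independent : ∀ {n} → Matroid n → Subset n → Set
Independent M X = rank M X ≡ ∣ X ∣

Loopless : ∀ {n} → Matroid n → Set
Loopless {n} M = ∀ i → rank M ⁅ i ⁆ ≡ 1

record LooplessPair (n : ℕ) : Set where
  field
    M₁ : Matroid n
    M₂ : Matroid n
    loopless₁ : Loopless M₁
    loopless₂ : Loopless M₂
open LooplessPair public

Oracle : Set → Set
Oracle A = ∀ {n} → LooplessPair n → Subset n → A

SumO : Oracle ℕ
SumO P X = rank (M₁ P) X + rank (M₂ P) X

MinO : Oracle ℕ
MinO P X = min (rank (M₁ P) X) (rank (M₂ P) X)

MaxO : Oracle ℕ
MaxO P X = max (rank (M₁ P) X) (rank (M₂ P) X)

CIO : Oracle Bool
CIO P X = ⌊ rank (M₁ P) X ≟ ∣ X ∣ ⌋ ∧ ⌊ rank (M₂ P) X ≟ ∣ X ∣ ⌋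

-- Adaptive query algorithms (decision trees) over subsets of Fin n,
-- receiving answers of type B and producing an output of type A.
data QTree (n : ℕ) (B A : Set) : Set where
  leaf  : A → QTree n B A
  query : Subset n → (B → QTree n B A) → QTree n B A

run : ∀ {n B A} → QTree n B A → (Subset n → B) → A × ℕ
run (leaf a)    O = a , 0
run (query X k) O with run (k (O X)) O
... | a , c = a , suc c

-- O₁ is polynomially reducible to O₂: there is a polynomial bound
-- c·(|E|+1)^k such that for every ground-set size n and every query X
-- there is a query algorithm (independent of the matroid pair) that, for
-- every pair of loopless matroids on Fin n, computes O₁'s answer to X
-- using at most c·(n+1)^k calls to O₂.
PolyReducible : ∀ {A B} → Oracle A → Oracle B → Set
PolyReducible {A} {B} O₁ O₂ =
  Σ ℕ λ c → Σ ℕ λ k →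
    ∀ n (X : Subset n) → Σ (QTree n B A) λ T →
      ∀ (P : LooplessPair n) →
        proj₁ (run T (O₂ P)) ≡ O₁ P X × proj₂ (run T (O₂ P)) ≤ c * suc n ^ k

{-# OPTIONS --safe #-}
-- An algorithm may query only the second oracle, so if two pairs of loopless
-- matroids give the same answer to every query of that oracle but differ in
-- their maximum rank, no reduction can exist. On four elements:
--   * U(1,4) with the free matroid, and U(1,4) with itself, agree under Min
--     and CI (a set is commonly independent iff it has at most one element),
--     while Max E is 4 resp. 1;
--   * the partition matroid with blocks {0,1}, {2,3} together with the free
--     matroid, and the two matroids in which {0,1} resp. {2,3} is a parallel
--     class, agree under Sum (both sums are |X| plus the number of blocks
--     met by X), while Max E is 4 resp. 3.
module Submission where

open import Defs
open import Data.Bool using (_∨_)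
open import Data.Bool.Properties using () renaming (_≟_ to _≟ᵇ_)
open import Data.Fin.Properties using (all?)
open import Data.Fin.Subset using (Subset; ∣_∣; ⁅_⁆; ⊤; _∪_; _∩_; _⊆_)
open import Data.Fin.Subset.Properties using (anySubset?; _⊆?_)
open import Data.Nat using (ℕ; _+_; _≤_; _≤?_; _≟_) renaming (_⊓_ to min)
open import Data.Product using (_×_; _,_; proj₁)
open import Data.Vec using (_∷_; [])
open import Function using (_∘_)
open import Relation.Binary.PropositionalEquality
  using (_≡_; _≢_; _≗_; refl; sym; cong; module ≡-Reasoning)
open import Relation.Nullary using (¬_; Dec)
open import Relation.Nullary.Decidable
  using (True; toWitness; from-yes; map′; ¬?; decidable-stable; _→-dec_)
open import Relation.Unary using (Pred; Decidable)

run-cong : ∀ {n B A} (T : QTree n B A) {O O′ : Subset n → B} →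
           O ≗ O′ → run T O ≡ run T O′
run-cong (leaf a)    O≗O′ = refl
run-cong (query X k) {O′ = O′} O≗O′
  rewrite O≗O′ X | run-cong (k (O′ X)) O≗O′ = refl

indistinguishable⇒¬PolyReducible :
  ∀ {A B} {O₁ : Oracle A} {O₂ : Oracle B} {n} (P Q : LooplessPair n) (X : Subset n) →
  O₂ P ≗ O₂ Q → O₁ P X ≢ O₁ Q X → ¬ PolyReducible O₁ O₂
indistinguishable⇒¬PolyReducible {O₁ = O₁} {O₂} {n} P Q X same differ (_ , _ , reduce)
  with reduce n X
... | T , correct = differ (begin
  O₁ P X                ≡⟨ sym (proj₁ (correct P)) ⟩
  proj₁ (run T (O₂ P))  ≡⟨ cong proj₁ (run-cong T same) ⟩
  proj₁ (run T (O₂ Q))  ≡⟨ proj₁ (correct Q) ⟩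
  O₁ Q X                ∎)
  where open ≡-Reasoning

allSubsets? : ∀ {n ℓ} {P : Pred (Subset n) ℓ} → Decidable P → Dec (∀ X → P X)
allSubsets? P? = map′
  (λ noCounterexample X → decidable-stable (P? X) (λ ¬PX → noCounterexample (X , ¬PX)))
  (λ ∀P (X , ¬PX) → ¬PX (∀P X))
  (¬? (anySubset? (¬? ∘ P?)))

module _ {n : ℕ} (r : Subset n → ℕ) where

  rank-≤? : Dec (∀ X → r X ≤ ∣ X ∣)
  rank-≤? = allSubsets? (λ X → r X ≤? ∣ X ∣)

  rank-mono? : Dec (∀ X Y → X ⊆ Y → r X ≤ r Y)
  rank-mono? = allSubsets? (λ X → allSubsets? (λ Y → X ⊆? Y →-dec r X ≤? r Y))

  rank-sub? : Dec (∀ X Y → r (X ∪ Y) + r (X ∩ Y) ≤ r X + r Y)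
  rank-sub? = allSubsets? (λ X → allSubsets? (λ Y → r (X ∪ Y) + r (X ∩ Y) ≤? r X + r Y))

  fromRank : {_ : True rank-≤?} {_ : True rank-mono?} {_ : True rank-sub?} → Matroid n
  fromRank {≤|X|} {mono} {sub} = record
    { rank      = r
    ; rank-≤    = toWitness ≤|X|
    ; rank-mono = toWitness mono
    ; rank-sub  = toWitness sub
    }

loopless? : ∀ {n} (M : Matroid n) → Dec (Loopless M)
loopless? M = all? (λ i → rank M ⁅ i ⁆ ≟ 1)

looplessPair : ∀ {n} (M N : Matroid n) →
               {_ : True (loopless? M)} {_ : True (loopless? N)} → LooplessPair n
looplessPair M N {loopless-M} {loopless-N} = record
  { M₁ = M ; M₂ = N ; loopless₁ = toWitness loopless-M ; loopless₂ = toWitness loopless-N }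

free uniform₁ : Matroid 4
free     = fromRank ∣_∣
uniform₁ = fromRank (λ X → min 1 ∣ X ∣)

-- Each rank function counts the parallel classes met by X.
parallel₀₁₂₃ parallel₀₁ parallel₂₃ : Matroid 4
parallel₀₁₂₃ = fromRank λ { (a ∷ b ∷ c ∷ d ∷ []) → ∣ (a ∨ b) ∷ (c ∨ d) ∷ [] ∣ }
parallel₀₁   = fromRank λ { (a ∷ b ∷ c ∷ d ∷ []) → ∣ (a ∨ b) ∷ c ∷ d ∷ [] ∣ }
parallel₂₃   = fromRank λ { (a ∷ b ∷ c ∷ d ∷ []) → ∣ a ∷ b ∷ (c ∨ d) ∷ [] ∣ }

uniform₁-free uniform₁-uniform₁ parallel₀₁₂₃-free parallel₀₁-parallel₂₃ : LooplessPair 4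
uniform₁-free         = looplessPair uniform₁ free
uniform₁-uniform₁     = looplessPair uniform₁ uniform₁
parallel₀₁₂₃-free     = looplessPair parallel₀₁₂₃ free
parallel₀₁-parallel₂₃ = looplessPair parallel₀₁ parallel₂₃

theorem3p4 : ¬ PolyReducible MaxO MinO × ¬ PolyReducible MaxO SumO × ¬ PolyReducible MaxO CIO
theorem3p4 =
    indistinguishable⇒¬PolyReducible uniform₁-free uniform₁-uniform₁ ⊤ min-agrees (λ ())
  , indistinguishable⇒¬PolyReducible parallel₀₁₂₃-free parallel₀₁-parallel₂₃ ⊤ sum-agrees (λ ())
  , indistinguishable⇒¬PolyReducible uniform₁-free uniform₁-uniform₁ ⊤ ci-agrees (λ ())
  where
  min-agrees : MinO uniform₁-free ≗ MinO uniform₁-uniform₁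
  min-agrees = from-yes (allSubsets? λ X →
    MinO uniform₁-free X ≟ MinO uniform₁-uniform₁ X)

  sum-agrees : SumO parallel₀₁₂₃-free ≗ SumO parallel₀₁-parallel₂₃
  sum-agrees = from-yes (allSubsets? λ X →
    SumO parallel₀₁₂₃-free X ≟ SumO parallel₀₁-parallel₂₃ X)

  ci-agrees : CIO uniform₁-free ≗ CIO uniform₁-uniform₁
  ci-agrees = from-yes (allSubsets? λ X →
    CIO uniform₁-free X ≟ᵇ CIO uniform₁-uniform₁ X)
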